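{- Let $T$ be a CNAT of size $n$ and let $l_1,l_2$ be two interacting leaves of $T$. Then the switch $S(T,l_1,l_2)$ is a CNAT of size $n$.
   Context: A non-ambiguous tree (NAT) is a filling of a rectangular grid in which each cell is dotted or not, such that: the top-left cell is dotted (the root); every dotted cell other than the root has either a dotted cell above it in the same column or a dotted cell to its left in the same row, but not both; and every row and every column contains at least one dotted cell. Each non-root dot has a parent: the nearest dot above it in its column, or the nearest dot to its left in its row. A complete non-ambiguous tree (CNAT) is a NAT in which every dot either has both a dot below it in its column and a dot to its right in its row (an internal dot), or neither (a leaf). The size of a CNAT is its number of leaves. Rows are labelled from top to bottom and columns from left to right; $r(d)$ and $c(d)$ denote the row and column of a dot $d$. A leaf is a left leaf if it lies in the same column as its parent, and a right leaf if it lies in the same row as its parent. Two left leaves $l_1,l_2$ with parents $p_1,p_2$ are interacting if $r(p_1)<r(l_2)<r(l_1)$ or $r(p_2)<r(l_1)<r(l_2)$; two right leaves are interacting if $c(p_1)<c(l_2)<c(l_1)$ or $c(p_2)<c(l_1)<c(l_2)$. For two interacting left leaves, the switch $S(T,l_1,l_2)$ is obtained by removing $l_1$ and $l_2$, placing a new dot in column $c(l_1)$ and row $r(l_2)$, and a new dot in column $c(l_2)$ and row $r(l_1)$ (i.e. exchanging the row labels of the two leaves); for two interacting right leaves, the switch exchanges their column labels in the same way. -}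

module Defs where

open import Data.Nat using (ℕ; suc)
open import Data.Fin using (Fin; zero; _<_; _≟_)
open import Data.Bool using (Bool; true; false; if_then_else_; _∧_; _∨_)
open import Data.Product using (Σ; _,_; ∃; ∃-syntax; _×_; proj₁; proj₂)
open import Data.Sum using (_⊎_)
open import Data.List using (List; length)
open import Data.List.Relation.Unary.Unique.Propositional using (Unique)
open import Data.List.Membership.Propositional using (_∈_)
open import Relation.Binary.PropositionalEquality using (_≡_)
open import Relation.Nullary using (¬_; ⌊_⌋)
open import Function.Bundles using (_⇔_)

-- Rows are numbered top to bottom, columns left to right; 'true' = dotted.
-- (A NAT always has a root, so the grid is non-empty.)
Grid : ℕ → ℕ → Set
Grid m k = Fin (suc m) → Fin (suc k) → Bool

Pos : ℕ → ℕ → Set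
Pos m k = Fin (suc m) × Fin (suc k)

module _ {m k : ℕ} (G : Grid m k) where

  Dot : Fin (suc m) → Fin (suc k) → Set
  Dot i j = G i j ≡ true

  DotAbove DotBelow DotLeft DotRight : Fin (suc m) → Fin (suc k) → Set
  DotAbove i j = ∃[ i' ] (i' < i × Dot i' j)
  DotBelow i j = ∃[ i' ] (i < i' × Dot i' j)
  DotLeft  i j = ∃[ j' ] (j' < j × Dot i j')
  DotRight i j = ∃[ j' ] (j < j' × Dot i j')

  record IsNAT : Set where
    field
      root    : Dot zero zero
      nonRoot : ∀ i j → Dot i j → ¬ (i ≡ zero × j ≡ zero) →
                (DotAbove i j × ¬ DotLeft i j) ⊎ (¬ DotAbove i j × DotLeft i j)
      rows    : ∀ i → ∃[ j ] Dot i j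
      cols    : ∀ j → ∃[ i ] Dot i j

  Internal Leaf : Pos m k → Set
  Internal (i , j) = Dot i j × DotBelow i j × DotRight i j
  Leaf (i , j) = Dot i j × ¬ DotBelow i j × ¬ DotRight i j

  record IsCNAT : Set where
    field
      nat      : IsNAT
      complete : ∀ i j → Dot i j → Internal (i , j) ⊎ Leaf (i , j)

  HasSize : ℕ → Set
  HasSize n = Σ (List (Pos m k)) λ L → Unique L × length L ≡ n × (∀ p → (p ∈ L) ⇔ Leaf p)

  ColParent : Pos m k → Pos m k → Set
  ColParent (pi , pj) (li , lj) =
    Dot pi pj × pj ≡ lj × pi < li × (∀ i → pi < i → i < li → ¬ Dot i lj)

  RowParent : Pos m k → Pos m k → Set
  RowParent (pi , pj) (li , lj) =
    Dot pi pj × pi ≡ li × pj < lj × (∀ j → pj < j → j < lj → ¬ Dot li j)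

  InteractingLeft : Pos m k → Pos m k → Set
  InteractingLeft l₁ l₂ =
    Leaf l₁ × Leaf l₂ ×
    ∃[ p₁ ] ∃[ p₂ ] (ColParent p₁ l₁ × ColParent p₂ l₂ ×
      ((proj₁ p₁ < proj₁ l₂ × proj₁ l₂ < proj₁ l₁) ⊎
       (proj₁ p₂ < proj₁ l₁ × proj₁ l₁ < proj₁ l₂)))

  InteractingRight : Pos m k → Pos m k → Set
  InteractingRight l₁ l₂ =
    Leaf l₁ × Leaf l₂ ×
    ∃[ p₁ ] ∃[ p₂ ] (RowParent p₁ l₁ × RowParent p₂ l₂ ×
      ((proj₂ p₁ < proj₂ l₂ × proj₂ l₂ < proj₂ l₁) ⊎
       (proj₂ p₂ < proj₂ l₁ × proj₂ l₁ < proj₂ l₂)))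

  private
    at : Fin (suc m) → Fin (suc k) → Fin (suc m) → Fin (suc k) → Bool
    at i j a b = ⌊ i ≟ a ⌋ ∧ ⌊ j ≟ b ⌋

  switchLeft : Pos m k → Pos m k → Grid m k
  switchLeft (r₁ , c₁) (r₂ , c₂) i j =
    if at i j r₂ c₁ ∨ at i j r₁ c₂ then true
    else if at i j r₁ c₁ ∨ at i j r₂ c₂ then false
    else G i j

  switchRight : Pos m k → Pos m k → Grid m k
  switchRight (r₁ , c₁) (r₂ , c₂) i j =
    if at i j r₁ c₂ ∨ at i j r₂ c₁ then true
    else if at i j r₁ c₁ ∨ at i j r₂ c₂ then false
    else G i j

-- The row of a left leaf holds no other dot: nothing to its right since it is a leaf, nothing
-- to its left since its parent lies above it. So switching two left leaves just exchanges their
-- rows. Interaction says that each leaf's parent lies above both rows, and a leaf is the lowest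
-- dot of its column, so every other dot of either column lies above both rows: the exchange
-- keeps the vertical order of the dots in every column. A row permutation with this property
-- that fixes the root row preserves the relations "dot above/below/left/right", hence the CNAT
-- axioms and the leaves. A right switch is a left switch of the transposed grid.
module Submission where

open import Defs
open import Data.Bool using (true; false; if_then_else_; _∧_; _∨_)
open import Data.Bool.Properties using (∧-comm; ¬-not)
open import Data.Empty using (⊥-elim)
open import Data.Fin using (Fin; zero; _<_; _≟_)
open import Data.Fin.Properties using (<-cmp; <-trans; <-asym; <⇒≢)
open import Data.Fin.Permutation using (Permutation′; transpose; _⟨$⟩ʳ_; _⟨$⟩ˡ_; inverseˡ; inverseʳ)
import Data.Fin.Permutation.Components as PC
open import Data.List using (map)
open import Data.List.Properties using (length-map)
open import Data.List.Relation.Unary.Unique.Propositional.Properties using (map⁺)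
open import Data.List.Membership.Propositional using (_∈_)
open import Data.List.Membership.Propositional.Properties using (∈-map⁺; ∈-map⁻)
open import Data.Nat using (ℕ; suc)
open import Data.Product using (_,_; _×_; proj₁; proj₂; swap; map₂)
import Data.Product as Product
open import Data.Product.Algebra using (×-comm)
open import Data.Product.Function.NonDependent.Propositional using (_×-↔_)
open import Data.Sum using (_⊎_; inj₁; inj₂)
import Data.Sum as Sum
open import Function using (flip; _∘_; _↔_; _⇔_; mk⇔; Inverse; Equivalence; Injection)
open import Function.Construct.Identity using (↔-id)
open import Function.Properties.Inverse using (↔⇒↣)
open import Relation.Binary.Definitions using (tri<; tri≈; tri>)
open import Relation.Binary.PropositionalEquality using (_≡_; _≢_; refl; sym; trans; cong; subst; subst₂)
open import Relation.Nullary using (¬_; Dec; yes; no; ⌊_⌋)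
open import Relation.Nullary.Decidable using (dec-true; dec-false)

<⇒≢0 : ∀ {n} {i j : Fin (suc n)} → i < j → j ≢ zero
<⇒≢0 () refl

transpose-matchˡ : ∀ {n} (i j : Fin n) → PC.transpose i j i ≡ j
transpose-matchˡ i j rewrite dec-true (i ≟ i) refl = refl

transpose-matchʳ : ∀ {n} (i j : Fin n) → PC.transpose i j j ≡ i
transpose-matchʳ i j with j ≟ i
... | yes j≡i = j≡i
... | no _ rewrite dec-true (j ≟ j) refl = refl

transpose-mismatch : ∀ {n} {i j k : Fin n} → k ≢ i → k ≢ j → PC.transpose i j k ≡ k
transpose-mismatch {i = i} {j} {k} k≢i k≢j
  rewrite dec-false (k ≟ i) k≢i | dec-false (k ≟ j) k≢j = refl

transpose-monotoneOn : ∀ {n} {r r' : Fin n} (P : Fin n → Set) →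
  (∀ {x y} → P x → P y → x ≢ y → y ≡ r ⊎ y ≡ r' → x < r × x < r') →
  ∀ {x y} → P x → P y → x < y → PC.transpose r r' x < PC.transpose r r' y
transpose-monotoneOn {r = r} {r'} P below {x} {y} px py x<y = byTarget (y ≟ r) (y ≟ r')
  where
  fixed : ∀ {z} → z < r × z < r' → PC.transpose r r' z ≡ z
  fixed (z<r , z<r') = transpose-mismatch (<⇒≢ z<r) (<⇒≢ z<r')

  byTarget : Dec (y ≡ r) → Dec (y ≡ r') → PC.transpose r r' x < PC.transpose r r' y
  byTarget (yes refl) _ rewrite transpose-matchˡ r r' | fixed (below px py (<⇒≢ x<y) (inj₁ refl)) =
    proj₂ (below px py (<⇒≢ x<y) (inj₁ refl))
  byTarget (no _) (yes refl) rewrite transpose-matchʳ r r' | fixed (below px py (<⇒≢ x<y) (inj₂ refl)) =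
    proj₁ (below px py (<⇒≢ x<y) (inj₂ refl))
  byTarget (no y≢r) (no y≢r') rewrite transpose-mismatch y≢r y≢r' = bySource (x ≟ r) (x ≟ r')
    where
    bySource : Dec (x ≡ r) → Dec (x ≡ r') → PC.transpose r r' x < y
    bySource (yes refl) _ = ⊥-elim (<-asym x<y (proj₁ (below py px y≢r (inj₁ refl))))
    bySource (no _) (yes refl) = ⊥-elim (<-asym x<y (proj₂ (below py px y≢r' (inj₂ refl))))
    bySource (no x≢r) (no x≢r') rewrite transpose-mismatch x≢r x≢r' = x<y

hasSize-↔ : ∀ {m k m' k'} {G : Grid m k} {H : Grid m' k'} {n} (e : Pos m k ↔ Pos m' k') →
  (∀ q → Leaf H q ⇔ Leaf G (Inverse.from e q)) → HasSize G n → HasSize H n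
hasSize-↔ {G = G} {H} e leaf⇔ (L , unique , length≡n , L⇔leaf) =
  map to L , map⁺ (Injection.injective (↔⇒↣ e)) unique , trans (length-map to L) length≡n ,
  λ q → mk⇔ (sound q) (complete q)
  where
  open Inverse e using (to; from; strictlyInverseˡ; strictlyInverseʳ)

  sound : ∀ q → q ∈ map to L → Leaf H q
  sound q q∈ with ∈-map⁻ to q∈
  ... | p , p∈L , refl = Equivalence.from (leaf⇔ (to p))
    (subst (Leaf G) (sym (strictlyInverseʳ p)) (Equivalence.to (L⇔leaf p) p∈L))

  complete : ∀ q → Leaf H q → q ∈ map to L
  complete q leaf = subst (_∈ map to L) (strictlyInverseˡ q)
    (∈-map⁺ to (Equivalence.from (L⇔leaf (from q)) (Equivalence.to (leaf⇔ q) leaf)))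

module _ {m k} {G : Grid m k} where

  leaf-column : ∀ {r c x} → Leaf G (r , c) → Dot G x c → x ≢ r → x < r
  leaf-column {r} {x = x} (_ , ¬below , _) d x≢r with <-cmp x r
  ... | tri< x<r _ _ = x<r
  ... | tri≈ _ x≡r _ = ⊥-elim (x≢r x≡r)
  ... | tri> _ _ r<x = ⊥-elim (¬below (x , r<x , d))

  leftLeaf-column : ∀ {r c a c' x r'} → Leaf G (r , c) → ColParent G (a , c') (r , c) →
    Dot G x c → x ≢ r → a < r' → x < r'
  leftLeaf-column {a = a} {x = x} leaf (_ , _ , _ , nearest) d x≢r a<r' with <-cmp x a
  ... | tri< x<a _ _ = <-trans x<a a<r'
  ... | tri≈ _ refl _ = a<r'
  ... | tri> _ _ a<x = ⊥-elim (nearest x a<x (leaf-column leaf d x≢r) d)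

  module _ (nat : IsNAT G) where
    open IsNAT nat

    colParent⇒¬DotLeft : ∀ {r c p} → Dot G r c → ColParent G p (r , c) → ¬ DotLeft G r c
    colParent⇒¬DotLeft {r} {c} {a , _} d (da , refl , a<r , _) left
      with nonRoot r c d (<⇒≢0 a<r ∘ proj₁)
    ... | inj₁ (_ , ¬left) = ¬left left
    ... | inj₂ (¬above , _) = ¬above (a , a<r , da)

    leftLeaf-row : ∀ {r c p j} → Leaf G (r , c) → ColParent G p (r , c) → Dot G r j → j ≡ c
    leftLeaf-row {c = c} {j = j} (d , _ , ¬right) parent dj with <-cmp j c
    ... | tri< j<c _ _ = ⊥-elim (colParent⇒¬DotLeft d parent (j , j<c , dj))
    ... | tri≈ _ j≡c _ = j≡c
    ... | tri> _ _ c<j = ⊥-elim (¬right (j , c<j , dj))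

ColumnMonotone : ∀ {m k} → Grid m k → (Fin (suc m) → Fin (suc m)) → Set
ColumnMonotone G σ = ∀ {x y j} → Dot G x j → Dot G y j → x < y → σ x < σ y

module RowPermutation {m k} {T S : Grid m k} (π : Permutation′ (suc m))
  (π-zero : π ⟨$⟩ʳ zero ≡ zero) (monotone : ColumnMonotone T (π ⟨$⟩ʳ_))
  (S≗ : ∀ i j → S i j ≡ T (π ⟨$⟩ˡ i) j) where

  dotS : ∀ {i j} → Dot T (π ⟨$⟩ˡ i) j → Dot S i j
  dotS {i} {j} = trans (S≗ i j)

  dotT : ∀ {i j} → Dot S i j → Dot T (π ⟨$⟩ˡ i) j
  dotT {i} {j} = trans (sym (S≗ i j))

  dotS-moved : ∀ {x j} → Dot T x j → Dot S (π ⟨$⟩ʳ x) j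
  dotS-moved {j = j} d = dotS (subst (λ x → Dot T x j) (sym (inverseˡ π)) d)

  monotone⁻ : ∀ {x y j} → Dot T (π ⟨$⟩ˡ x) j → Dot T (π ⟨$⟩ˡ y) j → x < y → π ⟨$⟩ˡ x < π ⟨$⟩ˡ y
  monotone⁻ {x} {y} dx dy x<y with <-cmp (π ⟨$⟩ˡ x) (π ⟨$⟩ˡ y)
  ... | tri< lt _ _ = lt
  ... | tri≈ _ eq _ = ⊥-elim (<⇒≢ x<y (trans (sym (inverseʳ π)) (trans (cong (π ⟨$⟩ʳ_) eq) (inverseʳ π))))
  ... | tri> _ _ gt = ⊥-elim (<-asym x<y (subst₂ _<_ (inverseʳ π) (inverseʳ π) (monotone dy dx gt)))

  above⁺ : ∀ {i j} → Dot T (π ⟨$⟩ˡ i) j → DotAbove T (π ⟨$⟩ˡ i) j → DotAbove S i j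
  above⁺ d (x , x< , dx) = π ⟨$⟩ʳ x , subst (π ⟨$⟩ʳ x <_) (inverseʳ π) (monotone dx d x<) , dotS-moved dx

  above⁻ : ∀ {i j} → Dot T (π ⟨$⟩ˡ i) j → DotAbove S i j → DotAbove T (π ⟨$⟩ˡ i) j
  above⁻ d (i' , i'< , di') = π ⟨$⟩ˡ i' , monotone⁻ (dotT di') d i'< , dotT di'

  below⁺ : ∀ {i j} → Dot T (π ⟨$⟩ˡ i) j → DotBelow T (π ⟨$⟩ˡ i) j → DotBelow S i j
  below⁺ d (x , <x , dx) = π ⟨$⟩ʳ x , subst (_< π ⟨$⟩ʳ x) (inverseʳ π) (monotone d dx <x) , dotS-moved dx

  below⁻ : ∀ {i j} → Dot T (π ⟨$⟩ˡ i) j → DotBelow S i j → DotBelow T (π ⟨$⟩ˡ i) j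
  below⁻ d (i' , <i' , di') = π ⟨$⟩ˡ i' , monotone⁻ d (dotT di') <i' , dotT di'

  leaf⁺ : ∀ {i j} → Leaf T (π ⟨$⟩ˡ i , j) → Leaf S (i , j)
  leaf⁺ (d , ¬below , ¬right) = dotS d , ¬below ∘ below⁻ d , ¬right ∘ map₂ (map₂ dotT)

  leaf⁻ : ∀ {i j} → Leaf S (i , j) → Leaf T (π ⟨$⟩ˡ i , j)
  leaf⁻ (d , ¬below , ¬right) = dotT d , ¬below ∘ below⁺ (dotT d) , ¬right ∘ map₂ (map₂ dotS)

  internal⁺ : ∀ {i j} → Internal T (π ⟨$⟩ˡ i , j) → Internal S (i , j)
  internal⁺ (d , below , right) = dotS d , below⁺ d below , map₂ (map₂ dotS) right

  isCNAT : IsCNAT T → IsCNAT S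
  isCNAT cnat = record
    { nat = record
      { root    = dotS (subst (λ x → Dot T x zero) (sym π⁻¹-zero) root)
      ; nonRoot = λ i j d notRoot → Sum.map
          (Product.map (above⁺ (dotT d)) (_∘ map₂ (map₂ dotT)))
          (Product.map (_∘ above⁻ (dotT d)) (map₂ (map₂ dotS)))
          (nonRoot (π ⟨$⟩ˡ i) j (dotT d) (notRoot ∘ Product.map₁ moved-from-zero))
      ; rows    = λ i → map₂ dotS (rows (π ⟨$⟩ˡ i))
      ; cols    = λ j → Product.map (π ⟨$⟩ʳ_) dotS-moved (cols j)
      }
    ; complete = λ i j d → Sum.map internal⁺ leaf⁺ (complete (π ⟨$⟩ˡ i) j (dotT d))
    }
    where
    open IsCNAT cnat
    open IsNAT nat

    π⁻¹-zero : π ⟨$⟩ˡ zero ≡ zero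
    π⁻¹-zero = trans (cong (π ⟨$⟩ˡ_) (sym π-zero)) (inverseˡ π)

    moved-from-zero : ∀ {i} → π ⟨$⟩ˡ i ≡ zero → i ≡ zero
    moved-from-zero eq = trans (sym (inverseʳ π)) (trans (cong (π ⟨$⟩ʳ_) eq) π-zero)

  hasSize : ∀ {n} → HasSize T n → HasSize S n
  hasSize = hasSize-↔ (π ×-↔ ↔-id _) (λ (i , j) → mk⇔ leaf⁻ leaf⁺)

module LeftLeafPair {m k} {T : Grid m k} (nat : IsNAT T) {r₁ r₂ a b c₁ c₂}
  (leaf₁ : Leaf T (r₁ , c₁)) (leaf₂ : Leaf T (r₂ , c₂))
  (parent₁ : ColParent T (a , c₁) (r₁ , c₁)) (parent₂ : ColParent T (b , c₂) (r₂ , c₂))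
  (a<r₂ : a < r₂) (b<r₁ : b < r₁) (r₁≢r₂ : r₁ ≢ r₂) where

  private
    a<r₁ : a < r₁
    a<r₁ = proj₁ (proj₂ (proj₂ parent₁))

    b<r₂ : b < r₂
    b<r₂ = proj₁ (proj₂ (proj₂ parent₂))

    row₁-empty : ∀ {j} → j ≢ c₁ → T r₁ j ≡ false
    row₁-empty j≢c₁ = ¬-not (j≢c₁ ∘ leftLeaf-row nat leaf₁ parent₁)

    row₂-empty : ∀ {j} → j ≢ c₂ → T r₂ j ≡ false
    row₂-empty j≢c₂ = ¬-not (j≢c₂ ∘ leftLeaf-row nat leaf₂ parent₂)

    belowBoth : ∀ {x y j} → Dot T x j → Dot T y j → x ≢ y → y ≡ r₁ ⊎ y ≡ r₂ → x < r₁ × x < r₂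
    belowBoth {x} dx dy x≢y (inj₁ refl) with leftLeaf-row nat leaf₁ parent₁ dy
    ... | refl = leftLeaf-column leaf₁ parent₁ dx x≢y a<r₁ , leftLeaf-column leaf₁ parent₁ dx x≢y a<r₂
    belowBoth {x} dx dy x≢y (inj₂ refl) with leftLeaf-row nat leaf₂ parent₂ dy
    ... | refl = leftLeaf-column leaf₂ parent₂ dx x≢y b<r₁ , leftLeaf-column leaf₂ parent₂ dx x≢y b<r₂

  columnMonotone : ColumnMonotone T (PC.transpose r₁ r₂)
  columnMonotone {j = j} = transpose-monotoneOn (λ x → Dot T x j) belowBoth

  transpose-zero : PC.transpose r₁ r₂ zero ≡ zero
  transpose-zero = transpose-mismatch (<⇒≢0 a<r₁ ∘ sym) (<⇒≢0 b<r₂ ∘ sym)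

  switchLeft≗rowTranspose : ∀ i j → switchLeft T (r₁ , c₁) (r₂ , c₂) i j ≡ T (PC.transpose r₂ r₁ i) j
  switchLeft≗rowTranspose i j = byCell (i ≟ r₁) (i ≟ r₂) (j ≟ c₁) (j ≟ c₂)
    where
    -- the body of switchLeft, with its position tests kept as decisions to split on
    byCell : (d₁ : Dec (i ≡ r₁)) (d₂ : Dec (i ≡ r₂)) (e₁ : Dec (j ≡ c₁)) (e₂ : Dec (j ≡ c₂)) →
      (if ⌊ d₂ ⌋ ∧ ⌊ e₁ ⌋ ∨ ⌊ d₁ ⌋ ∧ ⌊ e₂ ⌋ then true
       else if ⌊ d₁ ⌋ ∧ ⌊ e₁ ⌋ ∨ ⌊ d₂ ⌋ ∧ ⌊ e₂ ⌋ then false else T i j)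
      ≡ T (PC.transpose r₂ r₁ i) j
    byCell (yes refl) (yes r₁≡r₂) _ _ = ⊥-elim (r₁≢r₂ r₁≡r₂)
    byCell (yes refl) (no _) _ (yes refl) rewrite transpose-matchʳ r₂ r₁ = sym (proj₁ leaf₂)
    byCell (yes refl) (no _) (yes refl) (no j≢c₂) rewrite transpose-matchʳ r₂ r₁ = sym (row₂-empty j≢c₂)
    byCell (yes refl) (no _) (no j≢c₁) (no j≢c₂) rewrite transpose-matchʳ r₂ r₁ =
      trans (row₁-empty j≢c₁) (sym (row₂-empty j≢c₂))
    byCell (no _) (yes refl) (yes refl) _ rewrite transpose-matchˡ r₂ r₁ = sym (proj₁ leaf₁)
    byCell (no _) (yes refl) (no j≢c₁) (yes refl) rewrite transpose-matchˡ r₂ r₁ = sym (row₁-empty j≢c₁)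
    byCell (no _) (yes refl) (no j≢c₁) (no j≢c₂) rewrite transpose-matchˡ r₂ r₁ =
      trans (row₂-empty j≢c₂) (sym (row₁-empty j≢c₁))
    byCell (no i≢r₁) (no i≢r₂) _ _ = cong (λ x → T x j) (sym (transpose-mismatch i≢r₂ i≢r₁))

switchLeft-isCNAT×hasSize : ∀ {m k} {T S : Grid m k} {n l₁ l₂} → IsCNAT T → HasSize T n →
  InteractingLeft T l₁ l₂ → (∀ i j → S i j ≡ switchLeft T l₁ l₂ i j) → IsCNAT S × HasSize S n
switchLeft-isCNAT×hasSize {l₁ = r₁ , c₁} {r₂ , c₂} cnat size
  (leaf₁ , leaf₂ , (a , _) , (b , _) , parent₁@(_ , refl , a<r₁ , _) , parent₂@(_ , refl , b<r₂ , _) , crossing) S≗ =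
  Switched.isCNAT cnat , Switched.hasSize size
  where
  crossed : a < r₂ × b < r₁ × r₁ ≢ r₂
  crossed = Sum.[ (λ (a<r₂ , r₂<r₁) → a<r₂ , <-trans b<r₂ r₂<r₁ , <⇒≢ r₂<r₁ ∘ sym)
            , (λ (b<r₁ , r₁<r₂) → <-trans a<r₁ r₁<r₂ , b<r₁ , <⇒≢ r₁<r₂) ] crossing

  open LeftLeafPair (IsCNAT.nat cnat) leaf₁ leaf₂ parent₁ parent₂
    (proj₁ crossed) (proj₁ (proj₂ crossed)) (proj₂ (proj₂ crossed))
  module Switched = RowPermutation (transpose r₁ r₂) transpose-zero columnMonotone
    (λ i j → trans (S≗ i j) (switchLeft≗rowTranspose i j))

flip-internal : ∀ {m k} {G : Grid m k} {i j} → Internal G (i , j) → Internal (flip G) (j , i)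
flip-internal (d , below , right) = d , right , below

flip-leaf : ∀ {m k} {G : Grid m k} {i j} → Leaf G (i , j) → Leaf (flip G) (j , i)
flip-leaf (d , ¬below , ¬right) = d , ¬right , ¬below

module _ {m k} {G : Grid m k} where

  flip-isCNAT : IsCNAT G → IsCNAT (flip G)
  flip-isCNAT cnat = record
    { nat = record
      { root    = root
      ; nonRoot = λ j i d notRoot → Sum.swap (Sum.map swap swap (nonRoot i j d (notRoot ∘ swap)))
      ; rows    = cols
      ; cols    = rows
      }
    ; complete = λ j i d → Sum.map flip-internal flip-leaf (complete i j d)
    }
    where
    open IsCNAT cnat
    open IsNAT nat

  flip-hasSize : ∀ {n} → HasSize G n → HasSize (flip G) n
  flip-hasSize = hasSize-↔ (×-comm _ _) (λ (j , i) → mk⇔ (flip-leaf {G = flip G}) (flip-leaf {G = G}))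

  flip-interactingRight : ∀ {l₁ l₂} → InteractingRight G l₁ l₂ → InteractingLeft (flip G) (swap l₁) (swap l₂)
  flip-interactingRight (leaf₁ , leaf₂ , p₁ , p₂ , parent₁ , parent₂ , crossing) =
    flip-leaf {G = G} leaf₁ , flip-leaf {G = G} leaf₂ , swap p₁ , swap p₂ , parent₁ , parent₂ , crossing

  flip-switchRight : ∀ l₁ l₂ j i → flip (switchRight G l₁ l₂) j i ≡ switchLeft (flip G) (swap l₁) (swap l₂) j i
  flip-switchRight (r₁ , c₁) (r₂ , c₂) j i
    rewrite ∧-comm ⌊ j ≟ c₂ ⌋ ⌊ i ≟ r₁ ⌋ | ∧-comm ⌊ j ≟ c₁ ⌋ ⌊ i ≟ r₂ ⌋
          | ∧-comm ⌊ j ≟ c₁ ⌋ ⌊ i ≟ r₁ ⌋ | ∧-comm ⌊ j ≟ c₂ ⌋ ⌊ i ≟ r₂ ⌋ = refl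

proposition4 : ∀ {m k} (T : Grid m k) (n : ℕ) → IsCNAT T → HasSize T n →
    ∀ (l₁ l₂ : Pos m k) →
      (InteractingLeft T l₁ l₂ →
        IsCNAT (switchLeft T l₁ l₂) × HasSize (switchLeft T l₁ l₂) n) ×
      (InteractingRight T l₁ l₂ →
        IsCNAT (switchRight T l₁ l₂) × HasSize (switchRight T l₁ l₂) n)
proposition4 T n cnat size l₁ l₂ =
  (λ interacting → switchLeft-isCNAT×hasSize cnat size interacting (λ _ _ → refl)) ,
  (λ interacting → Product.map flip-isCNAT flip-hasSize
    (switchLeft-isCNAT×hasSize (flip-isCNAT cnat) (flip-hasSize size)
      (flip-interactingRight interacting) (flip-switchRight l₁ l₂)))
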